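{- Let $\{c_n\}$, $S$, $<$ and $X_n$ be as in the context. Let $\{a_n\}_{n\ge1}$ be a monotonically increasing sequence of rational numbers which is bounded from above, and let $X = \sup a_n$ (supremum in $(S,<)$). Then $L(X_{2n-1} - a_n)$ holds, i.e. for every $m\in\mathbb{N}$ there is $N\in\mathbb{N}$ with $|X_{2n-1}-a_n| < 1/m$ for all $n \ge N$.
   Context: $\{c_n\}_{n\ge1}$ is a sequence of positive integers with $c_n\mid c_{n+1}$ for all $n$. $S$ is the set of sequences $(q_n)_{n\ge0}$ of rationals such that: $q_0\in\mathbb{Z}$; $q_n\le1$ for $n\ge1$; if $q_1=1$ then $q_2\ne0$; if $q_m=0$ for some $m\ge1$ then $q_n=0$ for all $n\ge m$; there is a sequence of positive integers $\{a'_n\}$ with $a'_{n+1}\ge\frac{c_{n+1}}{c_n}a'_n(a'_n+1)$ for all $n\ge1$ and $q_n=c_n/a'_n$ whenever $n\ge1$, $q_n\ne0$; and for each $n\ge1$, if $q_{n+1}\ne0$ then $q_{n+2}\ne0$ or $a'_{n+1}>\frac{c_{n+1}}{c_n}a'_n(a'_n+1)$. Order: for distinct $P=(p_n),Q=(q_n)\in S$, with $i$ the least index with $p_i\ne q_i$: $P<Q$ iff $p_0<q_0$ when $i=0$, $p_i<q_i$ when $i$ is odd, $p_i>q_i$ when $i\ge2$ is even. Elements of $S$ with $q_m=0$ for some $m\ge1$ correspond to the rationals $q_0+\sum_{k\ge1}(-1)^{k-1}q_k$, giving an order-preserving bijection with $\mathbb{Q}$; thus $\mathbb{Q}\subset S$.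 Every nonempty bounded-above subset of $S$ has a supremum. For $X=(x_n)\in S$ and $n\ge1$, $X_n$ is the rational $(x_0,\dots,x_n,0,0,\dots)$, i.e. $x_0+\sum_{k=1}^n(-1)^{k-1}x_k$. -}

module Defs where

open import Data.Nat as ℕ using (ℕ; zero; suc; _∸_) renaming (_≤_ to _≤ℕ_; _<_ to _<ℕ_; _*_ to _*ℕ_; _+_ to _+ℕ_)
open import Data.Nat.Divisibility using (_∣_)
open import Data.Integer using (ℤ; +_)
open import Data.Rational using (ℚ; _/_; 0ℚ; 1ℚ; _+_; _-_; _<_; _≤_; -_)
open import Data.Bool using (Bool; true; false; if_then_else_)
open import Data.Product using (Σ; ∃; ∃-syntax; _×_; _,_)
open import Data.Sum using (_⊎_)
open import Relation.Binary.PropositionalEquality using (_≡_; _≢_)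

ℕ→ℚ : ℕ → ℚ
ℕ→ℚ m = + m / 1

-- frac m d = m / d as a rational (only used with d ≥ 1; frac m 0 = 0 is junk).
frac : ℕ → ℕ → ℚ
frac m zero    = 0ℚ
frac m (suc d) = + m / suc d

ValidC : (ℕ → ℕ) → Set
ValidC c = (∀ n → 1 ≤ℕ n → 1 ≤ℕ c n) × (∀ n → 1 ≤ℕ n → c n ∣ c (suc n))

-- Growth bound  a'_{n+1} ≥ (c_{n+1}/c_n) a'_n (a'_n + 1), written multiplied
-- through by c_n > 0 (c_{n+1}/c_n is an integer by divisibility).
GrowthGe : (ℕ → ℕ) → (ℕ → ℕ) → ℕ → Set
GrowthGe c a' n = c (suc n) *ℕ a' n *ℕ (a' n +ℕ 1) ≤ℕ c n *ℕ a' (suc n)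

GrowthGt : (ℕ → ℕ) → (ℕ → ℕ) → ℕ → Set
GrowthGt c a' n = c (suc n) *ℕ a' n *ℕ (a' n +ℕ 1) <ℕ c n *ℕ a' (suc n)

InS : (ℕ → ℕ) → (ℕ → ℚ) → Set
InS c q =
    (∃[ z ] q 0 ≡ z / 1)
  × (∀ n → 1 ≤ℕ n → q n ≤ 1ℚ)
  × (q 1 ≡ 1ℚ → q 2 ≢ 0ℚ)
  × (∀ m → 1 ≤ℕ m → q m ≡ 0ℚ → ∀ n → m ≤ℕ n → q n ≡ 0ℚ)
  × (∃[ a' ] ( (∀ n → 1 ≤ℕ n → 1 ≤ℕ a' n)
             × (∀ n → 1 ≤ℕ n → GrowthGe c a' n)
             × (∀ n → 1 ≤ℕ n → q n ≢ 0ℚ → q n ≡ frac (c n) (a' n))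
             × (∀ n → 1 ≤ℕ n → q (suc n) ≢ 0ℚ →
                   q (suc (suc n)) ≢ 0ℚ ⊎ GrowthGt c a' n)))

isOdd : ℕ → Bool
isOdd zero    = false
isOdd (suc n) = if isOdd n then false else true

cmpAt : ℕ → ℚ → ℚ → Set
cmpAt zero    p q = p < q
cmpAt (suc i) p q = if isOdd (suc i) then p < q else q < p

_<S_ : (ℕ → ℚ) → (ℕ → ℚ) → Set
P <S Q = ∃[ i ] ((∀ j → j <ℕ i → P j ≡ Q j) × cmpAt i (P i) (Q i))

_≈S_ : (ℕ → ℚ) → (ℕ → ℚ) → Set
P ≈S Q = ∀ n → P n ≡ Q n

_≤S_ : (ℕ → ℚ) → (ℕ → ℚ) → Set
P ≤S Q = P <S Q ⊎ P ≈S Q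

-- X_n = x_0 + Σ_{k=1}^n (-1)^{k-1} x_k.
sgnTerm : ℕ → ℚ → ℚ
sgnTerm k x = if isOdd k then x else - x

trunc : (ℕ → ℚ) → ℕ → ℚ
trunc X zero    = X 0
trunc X (suc n) = trunc X n + sgnTerm (suc n) (X (suc n))

-- Y ∈ S is the element of S corresponding to the rational r
-- (Y terminates in zeros and its value is r).
Represents : (ℕ → ℕ) → (ℕ → ℚ) → ℚ → Set
Represents c Y r = InS c Y × (∃[ m ] (1 ≤ℕ m × Y m ≡ 0ℚ × trunc Y m ≡ r))

IsUpperBoundS : (ℕ → ℕ) → (ℕ → ℚ) → (ℕ → ℚ) → Set
IsUpperBoundS c a X = ∀ n → 1 ≤ℕ n → ∀ Y → Represents c Y (a n) → Y ≤S X

IsSupS : (ℕ → ℕ) → (ℕ → ℚ) → (ℕ → ℚ) → Set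
IsSupS c a X =
  InS c X × IsUpperBoundS c a X × (∀ Z → InS c Z → IsUpperBoundS c a Z → X ≤S Z)

-- For X ∈ S the digits x_n (n ≥ 1) are non-negative, non-increasing and at most 1/n, so the
-- truncations alternate: every truncation after an even index k lies in [X_k, X_k + x_{k+1}], and
-- every truncation after an odd index k lies in [X_k − x_{k+1}, X_k].  At the first index i where
-- P < Q differ, the growth bound on the denominators forces p_i + q_{i+1} ≤ q_i (roles swapped at
-- even i), so the late truncations of P never exceed those of Q.  Every rational has a terminating
-- representative in S (a greedy expansion); hence a_n ≤ X_{2t+1} for all t, and a rational ρ below
-- some X_{2M} cannot exceed every a_n, since its representative would then be an upper bound
-- smaller than X (comparing it with the representatives of the a_n uses excluded middle).  For K
-- even and n large this squeezes X_K − 1/K ≤ a_n ≤ X_{2n−1} ≤ X_K + 1/K.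

module Submission where

open import Defs
open import Level using (0ℓ)
open import Axiom.ExcludedMiddle using (ExcludedMiddle)
open import Data.Nat using (ℕ; suc; _∸_) renaming (_≤_ to _≤ℕ_; _*_ to _*ℕ_)
open import Data.Rational using (ℚ; _≤_; _<_; _-_; ∣_∣)
open import Data.Product using (∃-syntax; _×_)

open import Data.Nat using (zero; z≤n; s≤s; _%_) renaming (_<_ to _<ℕ_; _+_ to _+ℕ_; _/_ to _/ℕ_)
import Data.Nat as ℕ
import Data.Nat.Properties as ℕP
import Data.Nat.DivMod as ℕD
open import Data.Nat.Divisibility using (divides)
import Data.Nat.Solver
open import Data.Integer as ℤ using (ℤ)
import Data.Integer.Properties as ℤP
import Data.Integer.DivMod as ℤD
import Data.Integer.Solver
open import Data.Rational using (mkℚ; _/_; 0ℚ; 1ℚ; _+_; -_; toℚᵘ)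
open import Data.Rational.Properties
import Data.Rational.Unnormalised as ℚᵘ
import Data.Rational.Unnormalised.Properties as ℚᵘP
import Data.Rational.Solver
open import Data.Bool using (true; false)
open import Data.Product using (_,_; proj₁; proj₂)
open import Data.Sum using (_⊎_; inj₁; inj₂; swap)
open import Data.Empty using (⊥; ⊥-elim)
open import Relation.Nullary using (yes; no)
open import Relation.Binary.PropositionalEquality
open import Relation.Binary.Definitions using (tri<; tri≈; tri>)

module ℕS = Data.Nat.Solver.+-*-Solver
module ℤS = Data.Integer.Solver.+-*-Solver
module ℚS = Data.Rational.Solver.+-*-Solver

frac-toℚᵘ : ∀ a d → toℚᵘ (frac a (suc d)) ℚᵘ.≃ ℚᵘ.mkℚᵘ (ℤ.+ a) d
frac-toℚᵘ a d = toℚᵘ-fromℚᵘ (ℚᵘ.mkℚᵘ (ℤ.+ a) d)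

*≤*⇒frac≤ : ∀ a b {d e} → 1 ≤ℕ d → 1 ≤ℕ e → a *ℕ e ≤ℕ b *ℕ d → frac a d ≤ frac b e
*≤*⇒frac≤ a b {suc d} {suc e} _ _ h = toℚᵘ-cancel-≤
  (ℚᵘP.≤-respʳ-≃ (ℚᵘP.≃-sym (frac-toℚᵘ b e))
    (ℚᵘP.≤-respˡ-≃ (ℚᵘP.≃-sym (frac-toℚᵘ a d))
    (ℚᵘ.*≤* (subst₂ ℤ._≤_ (ℤP.pos-* a (suc e)) (ℤP.pos-* b (suc d)) (ℤ.+≤+ h)))))

frac≤⇒*≤* : ∀ a b {d e} → 1 ≤ℕ d → 1 ≤ℕ e → frac a d ≤ frac b e → a *ℕ e ≤ℕ b *ℕ d
frac≤⇒*≤* a b {suc d} {suc e} _ _ h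
  with ℚᵘP.≤-respʳ-≃ (frac-toℚᵘ b e) (ℚᵘP.≤-respˡ-≃ (frac-toℚᵘ a d) (toℚᵘ-mono-≤ h))
... | ℚᵘ.*≤* p =
  ℤP.drop‿+≤+ (subst₂ ℤ._≤_ (sym (ℤP.pos-* a (suc e))) (sym (ℤP.pos-* b (suc d))) p)

*<*⇒frac< : ∀ a b {d e} → 1 ≤ℕ d → 1 ≤ℕ e → a *ℕ e <ℕ b *ℕ d → frac a d < frac b e
*<*⇒frac< a b {suc d} {suc e} _ _ h = toℚᵘ-cancel-<
  (ℚᵘP.<-respʳ-≃ (ℚᵘP.≃-sym (frac-toℚᵘ b e))
    (ℚᵘP.<-respˡ-≃ (ℚᵘP.≃-sym (frac-toℚᵘ a d))
    (ℚᵘ.*<* (subst₂ ℤ._<_ (ℤP.pos-* a (suc e)) (ℤP.pos-* b (suc d)) (ℤ.+<+ h)))))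

frac<⇒*<* : ∀ a b {d e} → 1 ≤ℕ d → 1 ≤ℕ e → frac a d < frac b e → a *ℕ e <ℕ b *ℕ d
frac<⇒*<* a b {suc d} {suc e} _ _ h
  with ℚᵘP.<-respʳ-≃ (frac-toℚᵘ b e) (ℚᵘP.<-respˡ-≃ (frac-toℚᵘ a d) (toℚᵘ-mono-< h))
... | ℚᵘ.*<* p =
  ℤP.drop‿+<+ (subst₂ ℤ._<_ (sym (ℤP.pos-* a (suc e))) (sym (ℤP.pos-* b (suc d))) p)

frac-+ : ∀ a b {d e} → 1 ≤ℕ d → 1 ≤ℕ e →
         frac a d + frac b e ≡ frac (a *ℕ e +ℕ b *ℕ d) (d *ℕ e)
frac-+ a b {suc d} {suc e} _ _ = toℚᵘ-injective (begin
  toℚᵘ (frac a (suc d) + frac b (suc e))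
    ≈⟨ toℚᵘ-homo-+ (frac a (suc d)) (frac b (suc e)) ⟩
  toℚᵘ (frac a (suc d)) ℚᵘ.+ toℚᵘ (frac b (suc e))
    ≈⟨ ℚᵘP.+-cong (frac-toℚᵘ a d) (frac-toℚᵘ b e) ⟩
  ℚᵘ.mkℚᵘ (ℤ.+ a ℤ.* ℤ.+ suc e ℤ.+ ℤ.+ b ℤ.* ℤ.+ suc d) _
    ≡⟨ cong (λ n → ℚᵘ.mkℚᵘ n _) numerator ⟩
  ℚᵘ.mkℚᵘ (ℤ.+ (a *ℕ suc e +ℕ b *ℕ suc d)) _
    ≈⟨ ℚᵘP.≃-sym (frac-toℚᵘ _ _) ⟩
  toℚᵘ (frac (a *ℕ suc e +ℕ b *ℕ suc d) (suc d *ℕ suc e)) ∎)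
  where
  open ℚᵘP.≃-Reasoning
  numerator : ℤ.+ a ℤ.* ℤ.+ suc e ℤ.+ ℤ.+ b ℤ.* ℤ.+ suc d ≡ ℤ.+ (a *ℕ suc e +ℕ b *ℕ suc d)
  numerator = trans (cong₂ ℤ._+_ (sym (ℤP.pos-* a (suc e))) (sym (ℤP.pos-* b (suc d))))
                    (sym (ℤP.pos-+ (a *ℕ suc e) _))

frac-cong : ∀ a b {d e} → 1 ≤ℕ d → 1 ≤ℕ e → a *ℕ e ≡ b *ℕ d → frac a d ≡ frac b e
frac-cong a b hd he eq =
  ≤-antisym (*≤*⇒frac≤ a b hd he (ℕP.≤-reflexive eq))
            (*≤*⇒frac≤ b a he hd (ℕP.≤-reflexive (sym eq)))

0≤frac : ∀ a d → 0ℚ ≤ frac a d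
0≤frac a zero    = ≤-refl
0≤frac a (suc d) = *≤*⇒frac≤ 0 a {1} (s≤s z≤n) (s≤s z≤n) z≤n

0<frac : ∀ {a d} → 1 ≤ℕ a → 1 ≤ℕ d → 0ℚ < frac a d
0<frac {a} {d} ha hd =
  *<*⇒frac< 0 a {1} (s≤s z≤n) hd (ℕP.≤-trans ha (ℕP.≤-reflexive (sym (ℕP.*-identityʳ a))))

frac-zero : ∀ d → frac 0 d ≡ 0ℚ
frac-zero zero    = refl
frac-zero (suc d) = frac-cong 0 0 {suc d} {1} (s≤s z≤n) (s≤s z≤n) refl

frac≢0 : ∀ {a d} → 1 ≤ℕ a → 1 ≤ℕ d → frac a d ≢ 0ℚ
frac≢0 ha hd eq = <-irrefl (sym eq) (0<frac ha hd)

frac-1-antitone : ∀ {d e} → 1 ≤ℕ d → d ≤ℕ e → frac 1 e ≤ frac 1 d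
frac-1-antitone {d} {e} d≥1 d≤e = *≤*⇒frac≤ 1 1 (ℕP.≤-trans d≥1 d≤e) d≥1
  (subst₂ _≤ℕ_ (sym (ℕP.*-identityˡ d)) (sym (ℕP.*-identityˡ e)) d≤e)

1/K+1/K<1/m : ∀ {m K} → 1 ≤ℕ m → 2 *ℕ m <ℕ K → frac 1 K + frac 1 K < frac 1 m
1/K+1/K<1/m {m} {K} m≥1 2m<K = subst (_< frac 1 m) (sym (frac-+ 1 1 K≥1 K≥1))
  (*<*⇒frac< (1 *ℕ K +ℕ 1 *ℕ K) 1 (ℕP.*-mono-≤ K≥1 K≥1) m≥1
    (subst₂ _<ℕ_ (ℕS.solve 2 (λ K m → K ℕS.:* (ℕS.con 2 ℕS.:* m)
                                ℕS.:= (ℕS.con 1 ℕS.:* K ℕS.:+ ℕS.con 1 ℕS.:* K) ℕS.:* m) refl K m)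
                 (sym (ℕP.*-identityˡ (K *ℕ K)))
                 (ℕP.*-monoʳ-< K {{ℕ.>-nonZero K≥1}} 2m<K)))
  where
  K≥1 : 1 ≤ℕ K
  K≥1 = ℕP.≤-trans (s≤s z≤n) 2m<K

p≤p+q : ∀ p {q} → 0ℚ ≤ q → p ≤ p + q
p≤p+q p h = subst (_≤ p + _) (+-identityʳ p) (+-monoʳ-≤ p h)

p-q≤p : ∀ p {q} → 0ℚ ≤ q → p - q ≤ p
p-q≤p p h = subst (p - _ ≤_) (+-identityʳ p) (+-monoʳ-≤ p (neg-antimono-≤ h))

p-q<p : ∀ p {q} → 0ℚ < q → p - q < p
p-q<p p h = subst (p - _ <_) (+-identityʳ p) (+-monoʳ-< p (neg-antimono-< h))

p≤q⇒0≤q-p : ∀ {p q} → p ≤ q → 0ℚ ≤ q - p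
p≤q⇒0≤q-p {p} {q} h = subst (_≤ q - p) (+-inverseʳ p) (+-monoˡ-≤ (- p) h)

p≤p+q-r : ∀ p {q r} → r ≤ q → p ≤ p + q - r
p≤p+q-r p {q} {r} h = subst (p ≤_) (sym (+-assoc p q (- r))) (p≤p+q p (p≤q⇒0≤q-p h))

p-q+r≤p : ∀ p {q r} → r ≤ q → p - q + r ≤ p
p-q+r≤p p {q} {r} h = subst (_≤ p)
  (ℚS.solve 3 (λ p q r → p ℚS.:- (q ℚS.:- r) ℚS.:= p ℚS.:- q ℚS.:+ r) refl p q r)
  (p-q≤p p (p≤q⇒0≤q-p h))

p+r≤q⇒a+p≤a+q-r : ∀ a {p q r} → p + r ≤ q → a + p ≤ a + q - r
p+r≤q⇒a+p≤a+q-r a {p} {q} {r} h = subst (_≤ a + q - r)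
  (ℚS.solve 3 (λ a p r → a ℚS.:+ (p ℚS.:+ r) ℚS.:- r ℚS.:= a ℚS.:+ p) refl a p r)
  (+-monoˡ-≤ (- r) (+-monoʳ-≤ a h))

q+r≤p⇒a-p+r≤a-q : ∀ a {p q r} → q + r ≤ p → a - p + r ≤ a - q
q+r≤p⇒a-p+r≤a-q a {p} {q} {r} h = subst₂ _≤_
  (ℚS.solve 4 (λ a p q r → a ℚS.:+ (q ℚS.:+ r) ℚS.:- p ℚS.:- q ℚS.:= a ℚS.:- p ℚS.:+ r) refl a p q r)
  (ℚS.solve 3 (λ a p q → a ℚS.:+ p ℚS.:- p ℚS.:- q ℚS.:= a ℚS.:- q) refl a p q)
  (+-monoˡ-≤ (- q) (+-monoˡ-≤ (- p) (+-monoʳ-≤ a h)))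

∣x-y∣≤δ+δ : ∀ {x y t δ} → y ≤ x → t - δ ≤ y → x ≤ t + δ → ∣ x - y ∣ ≤ δ + δ
∣x-y∣≤δ+δ {x} {y} {t} {δ} y≤x t-δ≤y x≤t+δ = begin
  ∣ x - y ∣              ≡⟨ 0≤p⇒∣p∣≡p (p≤q⇒0≤q-p y≤x) ⟩
  x - y                  ≤⟨ +-mono-≤ x≤t+δ (neg-antimono-≤ t-δ≤y) ⟩
  t + δ - (t - δ)        ≡⟨ ℚS.solve 2 (λ t δ → t ℚS.:+ δ ℚS.:- (t ℚS.:- δ) ℚS.:= δ ℚS.:+ δ)
                                       refl t δ ⟩
  δ + δ                  ∎
  where open ≤-Reasoning

integer<⇒+1≤ : ∀ {z w} → z / 1 < w / 1 → z / 1 + 1ℚ ≤ w / 1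
integer<⇒+1≤ {z} {w} z<w = toℚᵘ-cancel-≤
  (ℚᵘP.≤-respʳ-≃ (ℚᵘP.≃-sym (toℚᵘ-fromℚᵘ (ℚᵘ.mkℚᵘ w 0)))
    (ℚᵘP.≤-respˡ-≃ (ℚᵘP.≃-sym z+1≃) (ℚᵘ.*≤* z+1≤w)))
  where
  z+1≃ : toℚᵘ (z / 1 + 1ℚ) ℚᵘ.≃ ℚᵘ.mkℚᵘ (z ℤ.* ℤ.+ 1 ℤ.+ ℤ.+ 1 ℤ.* ℤ.+ 1) 0
  z+1≃ = ℚᵘP.≃-trans (toℚᵘ-homo-+ (z / 1) 1ℚ)
                     (ℚᵘP.+-cong (toℚᵘ-fromℚᵘ (ℚᵘ.mkℚᵘ z 0)) ℚᵘP.≃-refl)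
  z*1<w*1 : z ℤ.* ℤ.+ 1 ℤ.< w ℤ.* ℤ.+ 1
  z*1<w*1 with ℚᵘP.<-respʳ-≃ (toℚᵘ-fromℚᵘ (ℚᵘ.mkℚᵘ w 0))
                (ℚᵘP.<-respˡ-≃ (toℚᵘ-fromℚᵘ (ℚᵘ.mkℚᵘ z 0)) (toℚᵘ-mono-< z<w))
  ... | ℚᵘ.*<* p = p
  z+1≤w : (z ℤ.* ℤ.+ 1 ℤ.+ ℤ.+ 1 ℤ.* ℤ.+ 1) ℤ.* ℤ.+ 1 ℤ.≤ w ℤ.* ℤ.+ 1
  z+1≤w = subst (ℤ._≤ w ℤ.* ℤ.+ 1)
    (trans (ℤP.+-comm (ℤ.+ 1) (z ℤ.* ℤ.+ 1)) (sym (ℤP.*-identityʳ _))) (ℤP.i<j⇒suc[i]≤j z*1<w*1)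

beyond : ∀ (P : ℕ → Set) {i j} → i ≤ℕ j → (∀ d → P (i +ℕ d)) → P j
beyond P {i} i≤j h = subst P (ℕP.m+[n∸m]≡n i≤j) (h (_ ∸ i))

monotone⇒≤ : ∀ {a : ℕ → ℚ} → (∀ n → 1 ≤ℕ n → a n ≤ a (suc n)) →
             ∀ {m n} → 1 ≤ℕ m → m ≤ℕ n → a m ≤ a n
monotone⇒≤ {a} a-mono {m} m≥1 m≤n = beyond (λ n → a m ≤ a n) m≤n increasing
  where
  increasing : ∀ d → a m ≤ a (m +ℕ d)
  increasing zero    = ≤-reflexive (cong a (sym (ℕP.+-identityʳ m)))
  increasing (suc d) = ≤-trans (increasing d) (subst (λ k → a (m +ℕ d) ≤ a k) (sym (ℕP.+-suc m d))
    (a-mono (m +ℕ d) (ℕP.≤-trans m≥1 (ℕP.m≤m+n m d))))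

m≤n*m : ∀ m {n} → 1 ≤ℕ n → m ≤ℕ n *ℕ m
m≤n*m m n≥1 = ℕP.m≤n*m m _ {{ℕ.>-nonZero n≥1}}

*≤*⇒≤/ : ∀ x y d → x *ℕ suc d ≤ℕ y → x ≤ℕ y /ℕ suc d
*≤*⇒≤/ x y d h = subst (_≤ℕ y /ℕ suc d) (ℕD.m*n/n≡m x (suc d)) (ℕD./-monoˡ-≤ (suc d) h)

quotient-remainder-< : ∀ {m q r s} → m ≡ r +ℕ q *ℕ s → r <ℕ s → 1 ≤ℕ q → (q +ℕ 1) *ℕ r <ℕ m
quotient-remainder-< {m} {q} {r} {s} m≡ r<s q≥1 = begin-strict
  (q +ℕ 1) *ℕ r  ≡⟨ ℕS.solve 2 (λ q r → (q ℕS.:+ ℕS.con 1) ℕS.:* r ℕS.:= r ℕS.:+ q ℕS.:* r)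
                               refl q r ⟩
  r +ℕ q *ℕ r    <⟨ ℕP.+-monoʳ-< r (ℕP.*-monoʳ-< q {{ℕ.>-nonZero q≥1}} r<s) ⟩
  r +ℕ q *ℕ s    ≡⟨ sym m≡ ⟩
  m              ∎
  where open ℕP.≤-Reasoning

c*k≤A⇒c'*[1+k]≤A' : ∀ {c c' k A A'} → 1 ≤ℕ c → 1 ≤ℕ k → c *ℕ k ≤ℕ A →
                   c' *ℕ A *ℕ (A +ℕ 1) ≤ℕ c *ℕ A' → c' *ℕ suc k ≤ℕ A'
c*k≤A⇒c'*[1+k]≤A' {c} {c'} {k} {A} {A'} c≥1 k≥1 ck≤A growth =
  ℕP.*-cancelˡ-≤ c {{ℕ.>-nonZero c≥1}} (begin
  c *ℕ (c' *ℕ suc k)        ≡⟨ ℕS.solve 3 (λ c c' k → c ℕS.:* (c' ℕS.:* (ℕS.con 1 ℕS.:+ k))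
                                 ℕS.:= c' ℕS.:* (c ℕS.:+ c ℕS.:* k)) refl c c' k ⟩
  c' *ℕ (c +ℕ c *ℕ k)       ≤⟨ ℕP.*-monoʳ-≤ c' (ℕP.+-mono-≤ c≤A*A ck≤A) ⟩
  c' *ℕ (A *ℕ A +ℕ A)       ≡⟨ ℕS.solve 2 (λ c' A → c' ℕS.:* (A ℕS.:* A ℕS.:+ A)
                                 ℕS.:= c' ℕS.:* A ℕS.:* (A ℕS.:+ ℕS.con 1)) refl c' A ⟩
  c' *ℕ A *ℕ (A +ℕ 1)       ≤⟨ growth ⟩
  c *ℕ A'                   ∎)
  where
  open ℕP.≤-Reasoning
  c≤A*A : c ≤ℕ A *ℕ A
  c≤A*A = ℕP.≤-trans (ℕP.m≤m*n c k {{ℕ.>-nonZero k≥1}})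
    (ℕP.≤-trans ck≤A (ℕP.m≤m*n A A {{ℕ.>-nonZero (ℕP.≤-trans (ℕP.*-mono-≤ c≥1 k≥1) ck≤A)}}))

digit-gap-ℕ : ∀ C C' B B' t → C' *ℕ B *ℕ (B +ℕ 1) ≤ℕ C *ℕ B' →
              (C *ℕ B' +ℕ C' *ℕ (suc B +ℕ t)) *ℕ B ≤ℕ C *ℕ ((suc B +ℕ t) *ℕ B')
digit-gap-ℕ C C' B B' t growth = begin
  (C *ℕ B' +ℕ C' *ℕ (suc B +ℕ t)) *ℕ B
    ≡⟨ ℕS.solve 5 (λ C C' B B' t → (C ℕS.:* B' ℕS.:+ C' ℕS.:* (ℕS.con 1 ℕS.:+ B ℕS.:+ t)) ℕS.:* B
         ℕS.:= C ℕS.:* B' ℕS.:* B ℕS.:+ C' ℕS.:* B ℕS.:* (B ℕS.:+ ℕS.con 1)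
               ℕS.:+ C' ℕS.:* B ℕS.:* t)
         refl C C' B B' t ⟩
  C *ℕ B' *ℕ B +ℕ C' *ℕ B *ℕ (B +ℕ 1) +ℕ C' *ℕ B *ℕ t
    ≤⟨ ℕP.+-mono-≤ (ℕP.+-monoʳ-≤ (C *ℕ B' *ℕ B) growth)
                   (ℕP.*-monoˡ-≤ t (ℕP.≤-trans C'B≤C'B[B+1] growth)) ⟩
  C *ℕ B' *ℕ B +ℕ C *ℕ B' +ℕ C *ℕ B' *ℕ t
    ≡⟨ ℕS.solve 4 (λ C B B' t → C ℕS.:* B' ℕS.:* B ℕS.:+ C ℕS.:* B' ℕS.:+ C ℕS.:* B' ℕS.:* t
         ℕS.:= C ℕS.:* ((ℕS.con 1 ℕS.:+ B ℕS.:+ t) ℕS.:* B')) refl C B B' t ⟩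
  C *ℕ ((suc B +ℕ t) *ℕ B') ∎
  where
  open ℕP.≤-Reasoning
  C'B≤C'B[B+1] : C' *ℕ B ≤ℕ C' *ℕ B *ℕ (B +ℕ 1)
  C'B≤C'B[B+1] = ℕP.m≤m*n (C' *ℕ B) (B +ℕ 1) {{ℕ.>-nonZero (ℕP.m≤n+m 1 B)}}

m≤2*[m+n] : ∀ m n → m ≤ℕ 2 *ℕ (m +ℕ n)
m≤2*[m+n] m n = ℕP.≤-trans (ℕP.m≤m+n m n) (ℕP.m≤m+n (m +ℕ n) (m +ℕ n +ℕ 0))

2*[1+n]∸1≡1+2*n : ∀ n → 2 *ℕ suc n ∸ 1 ≡ suc (2 *ℕ n)
2*[1+n]∸1≡1+2*n n = ℕP.+-suc n (n +ℕ 0)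

2+m≤n⇒2*[1+m]≤2*n∸1 : ∀ {m n} → suc (suc m) ≤ℕ n → 2 *ℕ suc m ≤ℕ 2 *ℕ n ∸ 1
2+m≤n⇒2*[1+m]≤2*n∸1 {m} {n} 2+m≤n = ℕP.≤-trans (ℕP.n≤1+n _)
  (subst (_≤ℕ 2 *ℕ n ∸ 1) (2*[1+n]∸1≡1+2*n (suc m)) (ℕP.∸-monoˡ-≤ 1 (ℕP.*-monoʳ-≤ 2 2+m≤n)))

-- Truncations of elements of S

sgnTerm-odd : ∀ k → isOdd k ≡ true → ∀ x → sgnTerm k x ≡ x
sgnTerm-odd _ eq x rewrite eq = refl

sgnTerm-even : ∀ k → isOdd k ≡ false → ∀ x → sgnTerm k x ≡ - x
sgnTerm-even _ eq x rewrite eq = refl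

sgnTerm-zero : ∀ k → sgnTerm k 0ℚ ≡ 0ℚ
sgnTerm-zero k with isOdd k
... | true  = refl
... | false = refl

isOdd-suc-even : ∀ k → isOdd k ≡ false → isOdd (suc k) ≡ true
isOdd-suc-even _ eq rewrite eq = refl

isOdd-suc-odd : ∀ k → isOdd k ≡ true → isOdd (suc k) ≡ false
isOdd-suc-odd _ eq rewrite eq = refl

isOdd-2* : ∀ t → isOdd (2 *ℕ t) ≡ false
isOdd-2* t rewrite ℕP.+-identityʳ t = isOdd-double t
  where
  isOdd-double : ∀ t → isOdd (t +ℕ t) ≡ false
  isOdd-double zero    = refl
  isOdd-double (suc t) rewrite ℕP.+-suc t t | isOdd-double t = refl

isOdd-1+2* : ∀ t → isOdd (suc (2 *ℕ t)) ≡ true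
isOdd-1+2* t = isOdd-suc-even (2 *ℕ t) (isOdd-2* t)

trunc-suc-odd : ∀ X k → isOdd (suc k) ≡ true → trunc X (suc k) ≡ trunc X k + X (suc k)
trunc-suc-odd X k odd = cong (trunc X k +_) (sgnTerm-odd (suc k) odd (X (suc k)))

trunc-suc-even : ∀ X k → isOdd (suc k) ≡ false → trunc X (suc k) ≡ trunc X k - X (suc k)
trunc-suc-even X k even = cong (trunc X k +_) (sgnTerm-even (suc k) even (X (suc k)))

agree-below⇒trunc≡ : ∀ {P Q : ℕ → ℚ} {i} → (∀ j → j <ℕ i → P j ≡ Q j) →
                     ∀ {j} → j <ℕ i → trunc P j ≡ trunc Q j
agree-below⇒trunc≡ agree {zero}  j<i = agree 0 j<i
agree-below⇒trunc≡ agree {suc j} j<i = cong₂ _+_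
  (agree-below⇒trunc≡ agree (ℕP.<-trans (ℕP.n<1+n j) j<i)) (cong (sgnTerm (suc j)) (agree (suc j) j<i))

≈S⇒trunc≡ : ∀ {P Q} → P ≈S Q → ∀ k → trunc P k ≡ trunc Q k
≈S⇒trunc≡ P≈Q k = agree-below⇒trunc≡ (λ j _ → P≈Q j) (ℕP.n<1+n k)

module Digits (c : ℕ → ℕ) (vc : ValidC c) {X : ℕ → ℚ} (X∈S : InS c X) where
  private
    c≥1 = proj₁ vc

  integral-part : ∃[ z ] X 0 ≡ z / 1
  integral-part = proj₁ X∈S

  digit≤1 : ∀ n → 1 ≤ℕ n → X n ≤ 1ℚ
  digit≤1 = proj₁ (proj₂ X∈S)

  zero-persists : ∀ m → 1 ≤ℕ m → X m ≡ 0ℚ → ∀ n → m ≤ℕ n → X n ≡ 0ℚ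
  zero-persists = proj₁ (proj₂ (proj₂ (proj₂ X∈S)))

  a' : ℕ → ℕ
  a' = proj₁ (proj₂ (proj₂ (proj₂ (proj₂ X∈S))))

  a'≥1 : ∀ n → 1 ≤ℕ n → 1 ≤ℕ a' n
  a'≥1 = proj₁ (proj₂ (proj₂ (proj₂ (proj₂ (proj₂ X∈S)))))

  a'-growth : ∀ n → 1 ≤ℕ n → GrowthGe c a' n
  a'-growth = proj₁ (proj₂ (proj₂ (proj₂ (proj₂ (proj₂ (proj₂ X∈S))))))

  digit≡c/a' : ∀ n → 1 ≤ℕ n → X n ≢ 0ℚ → X n ≡ frac (c n) (a' n)
  digit≡c/a' = proj₁ (proj₂ (proj₂ (proj₂ (proj₂ (proj₂ (proj₂ (proj₂ X∈S)))))))

  0≤digit : ∀ n → 1 ≤ℕ n → 0ℚ ≤ X n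
  0≤digit n n≥1 with X n ≟ 0ℚ
  ... | yes x≡0 = ≤-reflexive (sym x≡0)
  ... | no  x≢0 = subst (0ℚ ≤_) (sym (digit≡c/a' n n≥1 x≢0)) (0≤frac (c n) (a' n))

  digit≢0-pred : ∀ n → 1 ≤ℕ n → X (suc n) ≢ 0ℚ → X n ≢ 0ℚ
  digit≢0-pred n n≥1 x≢0 x≡0 = x≢0 (zero-persists n n≥1 x≡0 (suc n) (ℕP.n≤1+n n))

  digit-antitone : ∀ n → 1 ≤ℕ n → X (suc n) ≤ X n
  digit-antitone n n≥1 with X (suc n) ≟ 0ℚ
  ... | yes x≡0 = subst (_≤ X n) (sym x≡0) (0≤digit n n≥1)
  ... | no  x≢0 =
    subst₂ _≤_ (sym (digit≡c/a' (suc n) (s≤s z≤n) x≢0))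
               (sym (digit≡c/a' n n≥1 (digit≢0-pred n n≥1 x≢0)))
      (*≤*⇒frac≤ _ _ (a'≥1 (suc n) (s≤s z≤n)) (a'≥1 n n≥1)
        (ℕP.≤-trans c'a≤c'a[a+1] (a'-growth n n≥1)))
    where
    c'a≤c'a[a+1] : c (suc n) *ℕ a' n ≤ℕ c (suc n) *ℕ a' n *ℕ (a' n +ℕ 1)
    c'a≤c'a[a+1] = ℕP.m≤m*n _ (a' n +ℕ 1) {{ℕ.>-nonZero (ℕP.m≤n+m 1 (a' n))}}

  digit≤1/n-step : ∀ k → X (suc k) ≤ frac 1 (suc k) → X (suc (suc k)) ≤ frac 1 (suc (suc k))
  digit≤1/n-step k ih with X (suc (suc k)) ≟ 0ℚ
  ... | yes x≡0 = subst (_≤ frac 1 (suc (suc k))) (sym x≡0) (0≤frac 1 (suc (suc k)))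
  ... | no  x≢0 = subst (_≤ frac 1 (suc (suc k))) (sym (digit≡c/a' (suc (suc k)) (s≤s z≤n) x≢0))
      (*≤*⇒frac≤ (c (suc (suc k))) 1 {e = suc (suc k)} (a'≥1 (suc (suc k)) (s≤s z≤n)) (s≤s z≤n)
        (subst (c (suc (suc k)) *ℕ suc (suc k) ≤ℕ_) (sym (ℕP.*-identityˡ _))
          (c*k≤A⇒c'*[1+k]≤A' {c' = c (suc (suc k))} (c≥1 (suc k) (s≤s z≤n)) (s≤s z≤n) previous
            (a'-growth (suc k) (s≤s z≤n)))))
    where
    previous : c (suc k) *ℕ suc k ≤ℕ a' (suc k)
    previous = subst (c (suc k) *ℕ suc k ≤ℕ_) (ℕP.*-identityˡ _)
      (frac≤⇒*≤* (c (suc k)) 1 {e = suc k} (a'≥1 (suc k) (s≤s z≤n)) (s≤s z≤n)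
        (subst (_≤ frac 1 (suc k)) (digit≡c/a' (suc k) (s≤s z≤n) (digit≢0-pred (suc k) (s≤s z≤n) x≢0))
          ih))

  digit≤1/n : ∀ n → 1 ≤ℕ n → X n ≤ frac 1 n
  digit≤1/n (suc zero)    n≥1 = digit≤1 1 n≥1
  digit≤1/n (suc (suc k)) _   = digit≤1/n-step k (digit≤1/n (suc k) (s≤s z≤n))

  trunc-bounds-even : ∀ i → isOdd i ≡ false → ∀ d →
    trunc X i ≤ trunc X (i +ℕ d) × trunc X (i +ℕ d) ≤ trunc X i + X (suc i)
  trunc-bounds-odd : ∀ i → isOdd i ≡ true → ∀ d →
    trunc X i - X (suc i) ≤ trunc X (i +ℕ d) × trunc X (i +ℕ d) ≤ trunc X i

  trunc-bounds-even i _ zero rewrite ℕP.+-identityʳ i =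
    ≤-refl , p≤p+q (trunc X i) (0≤digit (suc i) (s≤s z≤n))
  trunc-bounds-even i even (suc d) rewrite ℕP.+-suc i d =
      ≤-trans (subst (trunc X i ≤_) (cong (_- X (suc (suc i))) (sym step))
                (p≤p+q-r (trunc X i) (digit-antitone (suc i) (s≤s z≤n))))
              (proj₁ bounds)
    , subst (trunc X (suc i +ℕ d) ≤_) step (proj₂ bounds)
    where
    step = trunc-suc-odd X i (isOdd-suc-even i even)
    bounds = trunc-bounds-odd (suc i) (isOdd-suc-even i even) d
  trunc-bounds-odd i _ zero rewrite ℕP.+-identityʳ i =
    p-q≤p (trunc X i) (0≤digit (suc i) (s≤s z≤n)) , ≤-refl
  trunc-bounds-odd i odd (suc d) rewrite ℕP.+-suc i d =
      subst (_≤ trunc X (suc i +ℕ d)) step (proj₁ bounds)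
    , ≤-trans (subst (λ t → trunc X (suc i +ℕ d) ≤ t + X (suc (suc i))) step (proj₂ bounds))
              (p-q+r≤p (trunc X i) (digit-antitone (suc i) (s≤s z≤n)))
    where
    step = trunc-suc-even X i (isOdd-suc-odd i odd)
    bounds = trunc-bounds-even (suc i) (isOdd-suc-odd i odd) d

  even-trunc-≤ : ∀ {i j} → isOdd i ≡ false → i ≤ℕ j → trunc X i ≤ trunc X j
  even-trunc-≤ {i} even i≤j =
    beyond (λ j → trunc X i ≤ trunc X j) i≤j (λ d → proj₁ (trunc-bounds-even i even d))

  trunc-≤-even+digit : ∀ {i j} → isOdd i ≡ false → i ≤ℕ j → trunc X j ≤ trunc X i + X (suc i)
  trunc-≤-even+digit {i} even i≤j =
    beyond (λ j → trunc X j ≤ trunc X i + X (suc i)) i≤j (λ d → proj₂ (trunc-bounds-even i even d))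

  odd-trunc-digit-≤ : ∀ {i j} → isOdd i ≡ true → i ≤ℕ j → trunc X i - X (suc i) ≤ trunc X j
  odd-trunc-digit-≤ {i} odd i≤j =
    beyond (λ j → trunc X i - X (suc i) ≤ trunc X j) i≤j (λ d → proj₁ (trunc-bounds-odd i odd d))

  trunc-≤-odd : ∀ {i j} → isOdd i ≡ true → i ≤ℕ j → trunc X j ≤ trunc X i
  trunc-≤-odd {i} odd i≤j =
    beyond (λ j → trunc X j ≤ trunc X i) i≤j (λ d → proj₂ (trunc-bounds-odd i odd d))

  trunc-≤-even+1/i : ∀ {i j} → 1 ≤ℕ i → isOdd i ≡ false → i ≤ℕ j →
                     trunc X j ≤ trunc X i + frac 1 i
  trunc-≤-even+1/i {i} i≥1 even i≤j = ≤-trans (trunc-≤-even+digit even i≤j)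
    (+-monoʳ-≤ (trunc X i) (≤-trans (digit≤1/n (suc i) (s≤s z≤n)) (frac-1-antitone i≥1 (ℕP.n≤1+n i))))

-- With Q i = c_i/B, P i = c_i/A and A > B, the growth bound gives
-- Q (i+1) ≤ c_i/(B(B+1)) = c_i/B − c_i/(B+1) ≤ Q i − P i.
digit-gap : ∀ c → ValidC c → ∀ {P Q} → InS c P → InS c Q →
            ∀ i → 1 ≤ℕ i → P i < Q i → P i + Q (suc i) ≤ Q i
digit-gap c vc {P} {Q} P∈S Q∈S i i≥1 Pi<Qi with P i ≟ 0ℚ | Q (suc i) ≟ 0ℚ
... | yes Pi≡0 | _ =
  subst (_≤ Q i) (trans (sym (+-identityˡ _)) (cong (_+ Q (suc i)) (sym Pi≡0))) (Q.digit-antitone i i≥1)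
  where module Q = Digits c vc Q∈S
... | no _ | yes Qi'≡0 =
  subst (_≤ Q i) (trans (sym (+-identityʳ _)) (cong (P i +_) (sym Qi'≡0))) (<⇒≤ Pi<Qi)
... | no Pi≢0 | no Qi'≢0 = subst₂ _≤_ (sym (cong₂ _+_ Pi≡ Qi'≡)) (sym Qi≡)
      (subst (_≤ frac C B) (sym (frac-+ C C' A≥1 B'≥1))
        (*≤*⇒frac≤ _ C (ℕP.*-mono-≤ A≥1 B'≥1) B≥1
          (subst (λ a → (C *ℕ B' +ℕ C' *ℕ a) *ℕ B ≤ℕ C *ℕ (a *ℕ B')) (ℕP.m+[n∸m]≡n B<A)
            (digit-gap-ℕ C C' B B' (A ∸ suc B) (Q.a'-growth i i≥1)))))
  where
  module P = Digits c vc P∈S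
  module Q = Digits c vc Q∈S
  Qi≢0 : Q i ≢ 0ℚ
  Qi≢0 Qi≡0 = <-irrefl refl (≤-<-trans (P.0≤digit i i≥1) (subst (P i <_) Qi≡0 Pi<Qi))
  C = c i
  C' = c (suc i)
  A = P.a' i
  B = Q.a' i
  B' = Q.a' (suc i)
  A≥1 = P.a'≥1 i i≥1
  B≥1 = Q.a'≥1 i i≥1
  B'≥1 = Q.a'≥1 (suc i) (s≤s z≤n)
  Pi≡ = P.digit≡c/a' i i≥1 Pi≢0
  Qi≡ = Q.digit≡c/a' i i≥1 Qi≢0
  Qi'≡ = Q.digit≡c/a' (suc i) (s≤s z≤n) Qi'≢0
  B<A : B <ℕ A
  B<A = ℕP.*-cancelˡ-< C B A (frac<⇒*<* C C A≥1 B≥1 (subst₂ _<_ Pi≡ Qi≡ Pi<Qi))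

module Comparison (c : ℕ → ℕ) (vc : ValidC c) {P Q : ℕ → ℚ} (P∈S : InS c P) (Q∈S : InS c Q) where
  private
    module P = Digits c vc P∈S
    module Q = Digits c vc Q∈S

  first-difference⇒trunc-≤ : ∀ {i} → (∀ j → j <ℕ i → P j ≡ Q j) → cmpAt i (P i) (Q i) →
                             ∀ {j j'} → i ≤ℕ j → i ≤ℕ j' → trunc P j ≤ trunc Q j'
  first-difference⇒trunc-≤ {zero} _ P0<Q0 {j} {j'} _ _ with P.integral-part | Q.integral-part
  ... | z , P0≡z | w , Q0≡w = begin
    trunc P j    ≤⟨ P.trunc-≤-even+digit {0} {j} refl z≤n ⟩
    P 0 + P 1    ≤⟨ +-monoʳ-≤ (P 0) (P.digit≤1 1 (s≤s z≤n)) ⟩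
    P 0 + 1ℚ     ≡⟨ cong (_+ 1ℚ) P0≡z ⟩
    z / 1 + 1ℚ   ≤⟨ integer<⇒+1≤ {z} {w} (subst₂ _<_ P0≡z Q0≡w P0<Q0) ⟩
    w / 1        ≡⟨ sym Q0≡w ⟩
    Q 0          ≤⟨ Q.even-trunc-≤ {0} {j'} refl z≤n ⟩
    trunc Q j'   ∎
    where open ≤-Reasoning
  first-difference⇒trunc-≤ {suc i} agree cmp {j} {j'} i≤j i≤j' with isOdd (suc i) in parity
  ... | true = begin
    trunc P j                                ≤⟨ P.trunc-≤-odd parity i≤j ⟩
    trunc P (suc i)                          ≡⟨ trunc-suc-odd P i parity ⟩
    trunc P i + P (suc i)                    ≤⟨ p+r≤q⇒a+p≤a+q-r (trunc P i) gap ⟩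
    trunc P i + Q (suc i) - Q (suc (suc i))  ≡⟨ cong (λ t → t + Q (suc i) - Q (suc (suc i))) prefix ⟩
    trunc Q i + Q (suc i) - Q (suc (suc i))  ≡⟨ cong (_- Q (suc (suc i))) (trunc-suc-odd Q i parity) ⟨
    trunc Q (suc i) - Q (suc (suc i))        ≤⟨ Q.odd-trunc-digit-≤ parity i≤j' ⟩
    trunc Q j'                               ∎
    where
    open ≤-Reasoning
    gap : P (suc i) + Q (suc (suc i)) ≤ Q (suc i)
    gap = digit-gap c vc P∈S Q∈S (suc i) (s≤s z≤n) cmp
    prefix : trunc P i ≡ trunc Q i
    prefix = agree-below⇒trunc≡ agree (ℕP.n<1+n i)
  ... | false = begin
    trunc P j                                ≤⟨ P.trunc-≤-even+digit parity i≤j ⟩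
    trunc P (suc i) + P (suc (suc i))        ≡⟨ cong (_+ P (suc (suc i))) (trunc-suc-even P i parity) ⟩
    trunc P i - P (suc i) + P (suc (suc i))  ≤⟨ q+r≤p⇒a-p+r≤a-q (trunc P i) gap ⟩
    trunc P i - Q (suc i)                    ≡⟨ cong (_- Q (suc i)) prefix ⟩
    trunc Q i - Q (suc i)                    ≡⟨ trunc-suc-even Q i parity ⟨
    trunc Q (suc i)                          ≤⟨ Q.even-trunc-≤ parity i≤j' ⟩
    trunc Q j'                               ∎
    where
    open ≤-Reasoning
    gap : Q (suc i) + P (suc (suc i)) ≤ P (suc i)
    gap = digit-gap c vc Q∈S P∈S (suc i) (s≤s z≤n) cmp
    prefix : trunc P i ≡ trunc Q i
    prefix = agree-below⇒trunc≡ agree (ℕP.n<1+n i)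

  <S⇒trunc-≤ : P <S Q → ∀ {j} → isOdd j ≡ true → trunc P (suc j) ≤ trunc Q j
  <S⇒trunc-≤ (i , agree , cmp) {j} odd with ℕP.≤-<-connex i j
  ... | inj₁ i≤j = first-difference⇒trunc-≤ agree cmp (ℕP.m≤n⇒m≤1+n i≤j) i≤j
  ... | inj₂ j<i =
    ≤-trans (P.trunc-≤-odd {j} odd (ℕP.n≤1+n j)) (≤-reflexive (agree-below⇒trunc≡ {P} {Q} agree {j} j<i))

  ≤S⇒trunc-≤ : P ≤S Q → ∀ {j} → isOdd j ≡ true → trunc P (suc j) ≤ trunc Q j
  ≤S⇒trunc-≤ (inj₁ P<Q) {j} odd = <S⇒trunc-≤ P<Q {j} odd
  ≤S⇒trunc-≤ (inj₂ P≈Q) {j} odd =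
    subst (_≤ trunc Q j) (sym (≈S⇒trunc≡ P≈Q (suc j))) (Q.trunc-≤-odd {j} odd (ℕP.n≤1+n j))

-- Representing rationals in S

-- Greedy expansion of u₁/D: the remainder at step k is num k / den k, the digit c_k/a'_k is the
-- smallest admissible one above it (a'_k = ⌊c_k·den k / num k⌋), and what is left over is
-- (c_k·den k mod num k) / (a'_k·den k).  Numerators strictly decrease, so the expansion stops.
module Expansion (c : ℕ → ℕ) (vc : ValidC c) (z : ℤ) (u₁ D : ℕ) (D≥1 : 1 ≤ℕ D) (u₁<D : u₁ <ℕ D)
  where
  private
    c≥1 = proj₁ vc
    c∣c' = proj₂ vc

  remainder : ℕ → ℕ → ℕ → ℕ
  remainder k zero    v = 0
  remainder k (suc u) v = (c k *ℕ v) % suc u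

  -- After the expansion has stopped (u = 0), a'_k is the least value the growth bound allows.
  denominator : ℕ → ℕ → ℕ → ℕ → ℕ
  denominator k zero    v a = c k *ℕ a *ℕ (a +ℕ 1)
  denominator k (suc u) v a = (c k *ℕ v) /ℕ suc u

  digit : ℕ → ℕ → ℕ → ℚ
  digit k zero    a = 0ℚ
  digit k (suc _) a = frac (c k) a

  num : ℕ → ℕ
  den : ℕ → ℕ
  a' : ℕ → ℕ
  num zero                = 0
  num (suc zero)          = u₁
  num (suc (suc k))       = remainder (suc k) (num (suc k)) (den (suc k))
  den zero                = 1
  den (suc zero)          = D
  den (suc (suc k))       = a' (suc k) *ℕ den (suc k)
  a' zero                 = 1
  a' (suc k)              = denominator (suc k) (num (suc k)) (den (suc k)) (a' k)

  Y : ℕ → ℚ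
  Y zero    = z / 1
  Y (suc k) = digit (suc k) (num (suc k)) (a' (suc k))

  tail : ℕ → ℚ
  tail k = frac (num k) (den k)

  value : ℚ
  value = z / 1 + frac u₁ D

  c≤denominator : ∀ k u v a → suc u ≤ℕ v → c k ≤ℕ denominator k (suc u) v a
  c≤denominator k u v a u<v = *≤*⇒≤/ (c k) (c k *ℕ v) u (ℕP.*-monoʳ-≤ (c k) u<v)

  denominator≥1 : ∀ k u v a → 1 ≤ℕ k → u <ℕ v → 1 ≤ℕ a → 1 ≤ℕ denominator k u v a
  denominator≥1 k zero    v a k≥1 _   a≥1 =
    ℕP.*-mono-≤ (ℕP.*-mono-≤ (c≥1 k k≥1) a≥1) (ℕP.m≤n+m 1 a)
  denominator≥1 k (suc u) v a k≥1 u<v _   =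
    ℕP.≤-trans (c≥1 k k≥1) (c≤denominator k u v a (ℕP.<⇒≤ u<v))

  remainder≤pred : ∀ k u v → remainder k u v ≤ℕ ℕ.pred u
  remainder≤pred k zero    v = z≤n
  remainder≤pred k (suc u) v = ℕP.≤-pred (ℕD.m%n<n (c k *ℕ v) (suc u))

  den≥1 : ∀ k → 1 ≤ℕ den k
  a'≥1 : ∀ k → 1 ≤ℕ a' k
  num<den : ∀ k → num (suc k) <ℕ den (suc k)
  den≥1 zero          = s≤s z≤n
  den≥1 (suc zero)    = D≥1
  den≥1 (suc (suc k)) = ℕP.*-mono-≤ (a'≥1 (suc k)) (den≥1 (suc k))
  a'≥1 zero    = s≤s z≤n
  a'≥1 (suc k) = denominator≥1 (suc k) (num (suc k)) (den (suc k)) (a' k) (s≤s z≤n) (num<den k) (a'≥1 k)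
  num<den zero    = u₁<D
  num<den (suc k) =
    ℕP.≤-<-trans (ℕP.≤-trans (remainder≤pred (suc k) (num (suc k)) (den (suc k))) ℕP.pred[n]≤n)
                 (ℕP.<-≤-trans (num<den k) (m≤n*m (den (suc k)) (a'≥1 (suc k))))

  num≤u₁∸ : ∀ k → num (suc k) ≤ℕ u₁ ∸ k
  num≤u₁∸ zero    = ℕP.≤-refl
  num≤u₁∸ (suc k) = subst (num (suc (suc k)) ≤ℕ_) (ℕP.pred[m∸n]≡m∸[1+n] u₁ k)
    (ℕP.≤-trans (remainder≤pred (suc k) (num (suc k)) (den (suc k))) (ℕP.pred-mono-≤ (num≤u₁∸ k)))

  num-terminates : num (suc u₁) ≡ 0
  num-terminates = ℕP.n≤0⇒n≡0 (subst (num (suc u₁) ≤ℕ_) (ℕP.n∸n≡0 u₁) (num≤u₁∸ u₁))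

  num-stays-zero : ∀ {m n} → 1 ≤ℕ m → m ≤ℕ n → num m ≡ 0 → num n ≡ 0
  num-stays-zero {suc k} _ m≤n num≡0 = beyond (λ n → num n ≡ 0) m≤n stays
    where
    stays : ∀ d → num (suc k +ℕ d) ≡ 0
    stays zero    rewrite ℕP.+-identityʳ k = num≡0
    stays (suc d) rewrite ℕP.+-suc k d | stays d = refl

  digit≡0⇒num≡0 : ∀ {k u a} → 1 ≤ℕ k → 1 ≤ℕ a → digit k u a ≡ 0ℚ → u ≡ 0
  digit≡0⇒num≡0 {u = zero}  _   _   _   = refl
  digit≡0⇒num≡0 {u = suc u} k≥1 a≥1 eq0 = ⊥-elim (frac≢0 (c≥1 _ k≥1) a≥1 eq0)

  digit≢0⇒≡c/a : ∀ {k u a} → digit k u a ≢ 0ℚ → digit k u a ≡ frac (c k) a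
  digit≢0⇒≡c/a {u = zero}  ≢0 = ⊥-elim (≢0 refl)
  digit≢0⇒≡c/a {u = suc u} _  = refl

  digit≤1 : ∀ k u v a → 1 ≤ℕ k → u <ℕ v → 1 ≤ℕ a → digit k u (denominator k u v a) ≤ 1ℚ
  digit≤1 k zero    v a _   _   _   = <⇒≤ (0<frac {1} {1} (s≤s z≤n) (s≤s z≤n))
  digit≤1 k (suc u) v a k≥1 u<v a≥1 =
    *≤*⇒frac≤ (c k) 1 {e = 1} (denominator≥1 k (suc u) v a k≥1 u<v a≥1) (s≤s z≤n)
      (subst₂ _≤ℕ_ (sym (ℕP.*-identityʳ (c k))) (sym (ℕP.*-identityˡ _))
        (c≤denominator k u v a (ℕP.<⇒≤ u<v)))

  Y≡0⇒num≡0 : ∀ n → 1 ≤ℕ n → Y n ≡ 0ℚ → num n ≡ 0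
  Y≡0⇒num≡0 (suc k) k≥1 = digit≡0⇒num≡0 k≥1 (a'≥1 (suc k))

  num≡0⇒Y≡0 : ∀ n → 1 ≤ℕ n → num n ≡ 0 → Y n ≡ 0ℚ
  num≡0⇒Y≡0 (suc k) _ num≡0 rewrite num≡0 = refl

  digit≡remainders : ∀ k u v a → 1 ≤ℕ k → 1 ≤ℕ v → u <ℕ v → 1 ≤ℕ a →
    digit k u (denominator k u v a) ≡ frac u v + frac (remainder k u v) (denominator k u v a *ℕ v)
  digit≡remainders k zero v a _ _ _ _ =
    sym (trans (cong₂ _+_ (frac-zero v) (frac-zero (denominator k 0 v a *ℕ v))) (+-identityʳ 0ℚ))
  digit≡remainders k (suc u) v a k≥1 v≥1 u<v a≥1 =
    trans (frac-cong (c k) _ {d = A} A≥1 (ℕP.*-mono-≤ v≥1 (ℕP.*-mono-≤ A≥1 v≥1)) cross)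
          (sym (frac-+ (suc u) r v≥1 (ℕP.*-mono-≤ A≥1 v≥1)))
    where
    A = denominator k (suc u) v a
    r = remainder k (suc u) v
    A≥1 = denominator≥1 k (suc u) v a k≥1 u<v a≥1
    cross : c k *ℕ (v *ℕ (A *ℕ v)) ≡ (suc u *ℕ (A *ℕ v) +ℕ r *ℕ v) *ℕ A
    cross = begin
      c k *ℕ (v *ℕ (A *ℕ v))      ≡⟨ ℕS.solve 3 (λ C v A → C ℕS.:* (v ℕS.:* (A ℕS.:* v))
                                       ℕS.:= v ℕS.:* A ℕS.:* (C ℕS.:* v)) refl (c k) v A ⟩
      v *ℕ A *ℕ (c k *ℕ v)        ≡⟨ cong (v *ℕ A *ℕ_) (ℕD.m≡m%n+[m/n]*n (c k *ℕ v) (suc u)) ⟩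
      v *ℕ A *ℕ (r +ℕ A *ℕ suc u) ≡⟨ ℕS.solve 4 (λ v A r s → v ℕS.:* A ℕS.:* (r ℕS.:+ A ℕS.:* s)
                                       ℕS.:= (s ℕS.:* (A ℕS.:* v) ℕS.:+ r ℕS.:* v) ℕS.:* A)
                                       refl v A r (suc u) ⟩
      (suc u *ℕ (A *ℕ v) +ℕ r *ℕ v) *ℕ A ∎
      where open ≡-Reasoning

  Y≡tail+tail : ∀ k → Y (suc k) ≡ tail (suc k) + tail (suc (suc k))
  Y≡tail+tail k = digit≡remainders (suc k) (num (suc k)) (den (suc k)) (a' k)
                    (s≤s z≤n) (den≥1 (suc k)) (num<den k) (a'≥1 k)

  value≡trunc+tail : ∀ k → value ≡ trunc Y k + sgnTerm (suc k) (tail (suc k))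
  value≡trunc+tail zero    = refl
  value≡trunc+tail (suc k) = trans (value≡trunc+tail k) (telescope refl)
    where
    T = trunc Y k
    t₁ = tail (suc k)
    t₂ = tail (suc (suc k))
    open ≡-Reasoning
    telescope : ∀ {b} → isOdd (suc k) ≡ b →
                T + sgnTerm (suc k) t₁ ≡ T + sgnTerm (suc k) (Y (suc k)) + sgnTerm (suc (suc k)) t₂
    telescope {true} odd = begin
      T + sgnTerm (suc k) t₁  ≡⟨ cong (T +_) (sgnTerm-odd (suc k) odd t₁) ⟩
      T + t₁                  ≡⟨ ℚS.solve 3 (λ T t₁ t₂ → T ℚS.:+ t₁
                                                      ℚS.:= T ℚS.:+ (t₁ ℚS.:+ t₂) ℚS.:- t₂)
                                   refl T t₁ t₂ ⟩
      T + (t₁ + t₂) - t₂      ≡⟨ cong₂ (λ y w → T + y + w)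
                                   (sym (trans (sgnTerm-odd (suc k) odd _) (Y≡tail+tail k)))
                                   (sym (sgnTerm-even (suc (suc k)) (isOdd-suc-odd (suc k) odd) t₂)) ⟩
      T + sgnTerm (suc k) (Y (suc k)) + sgnTerm (suc (suc k)) t₂ ∎
    telescope {false} even = begin
      T + sgnTerm (suc k) t₁  ≡⟨ cong (T +_) (sgnTerm-even (suc k) even t₁) ⟩
      T - t₁                  ≡⟨ ℚS.solve 3 (λ T t₁ t₂ → T ℚS.:- t₁
                                                      ℚS.:= T ℚS.:- (t₁ ℚS.:+ t₂) ℚS.:+ t₂)
                                   refl T t₁ t₂ ⟩
      T - (t₁ + t₂) + t₂      ≡⟨ cong₂ (λ y w → T + y + w)
                                   (sym (trans (sgnTerm-even (suc k) even _) (cong -_ (Y≡tail+tail k))))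
                                   (sym (sgnTerm-odd (suc (suc k)) (isOdd-suc-even (suc k) even) t₂)) ⟩
      T + sgnTerm (suc k) (Y (suc k)) + sgnTerm (suc (suc k)) t₂ ∎

  denominator-growth : ∀ n u v a → 1 ≤ℕ n → u <ℕ v → 1 ≤ℕ a →
    c (suc n) *ℕ denominator n u v a *ℕ (denominator n u v a +ℕ 1)
      ≤ℕ c n *ℕ denominator (suc n) (remainder n u v) (denominator n u v a *ℕ v) (denominator n u v a)
  denominator-growth n zero    v a n≥1 _   _   = m≤n*m _ (c≥1 n n≥1)
  denominator-growth n (suc u) v a n≥1 u<v a≥1 =
    growth (remainder n (suc u) v) (ℕD.m≡m%n+[m/n]*n (c n *ℕ v) (suc u)) (ℕD.m%n<n (c n *ℕ v) (suc u))
    where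
    A = denominator n (suc u) v a
    A≥1 = denominator≥1 n (suc u) v a n≥1 u<v a≥1
    growth : ∀ r → c n *ℕ v ≡ r +ℕ A *ℕ suc u → r <ℕ suc u →
             c (suc n) *ℕ A *ℕ (A +ℕ 1) ≤ℕ c n *ℕ denominator (suc n) r (A *ℕ v) A
    growth zero    _   _   = m≤n*m _ (c≥1 n n≥1)
    growth (suc w) cv≡ r<s with c∣c' n n≥1
    ... | divides q c'≡qc = begin
      c (suc n) *ℕ A *ℕ (A +ℕ 1)                 ≡⟨ cong (λ x → x *ℕ A *ℕ (A +ℕ 1)) c'≡qc ⟩
      q *ℕ c n *ℕ A *ℕ (A +ℕ 1)
        ≡⟨ ℕS.solve 3 (λ q C A → q ℕS.:* C ℕS.:* A ℕS.:* (A ℕS.:+ ℕS.con 1)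
             ℕS.:= C ℕS.:* (q ℕS.:* A ℕS.:* (A ℕS.:+ ℕS.con 1))) refl q (c n) A ⟩
      c n *ℕ (q *ℕ A *ℕ (A +ℕ 1))                ≤⟨ ℕP.*-monoʳ-≤ (c n) (*≤*⇒≤/ _ _ w bound) ⟩
      c n *ℕ (c (suc n) *ℕ (A *ℕ v) /ℕ suc w)    ∎
      where
      open ℕP.≤-Reasoning
      bound : q *ℕ A *ℕ (A +ℕ 1) *ℕ suc w ≤ℕ c (suc n) *ℕ (A *ℕ v)
      bound = begin
        q *ℕ A *ℕ (A +ℕ 1) *ℕ suc w    ≡⟨ ℕP.*-assoc (q *ℕ A) (A +ℕ 1) (suc w) ⟩
        q *ℕ A *ℕ ((A +ℕ 1) *ℕ suc w)  ≤⟨ ℕP.*-monoʳ-≤ (q *ℕ A)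
                                              (ℕP.<⇒≤ (quotient-remainder-< cv≡ r<s A≥1)) ⟩
        q *ℕ A *ℕ (c n *ℕ v)           ≡⟨ ℕS.solve 4 (λ q A C v → q ℕS.:* A ℕS.:* (C ℕS.:* v)
                                             ℕS.:= q ℕS.:* C ℕS.:* (A ℕS.:* v)) refl q A (c n) v ⟩
        q *ℕ c n *ℕ (A *ℕ v)           ≡⟨ cong (_*ℕ (A *ℕ v)) (sym c'≡qc) ⟩
        c (suc n) *ℕ (A *ℕ v)          ∎

  denominator-strict : ∀ n u v a → 1 ≤ℕ n → u <ℕ v → 1 ≤ℕ a → remainder n u v ≢ 0 →
      remainder (suc n) (remainder n u v) (denominator n u v a *ℕ v) ≢ 0
    ⊎ c (suc n) *ℕ denominator n u v a *ℕ (denominator n u v a +ℕ 1)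
        <ℕ c n *ℕ denominator (suc n) (remainder n u v) (denominator n u v a *ℕ v) (denominator n u v a)
  denominator-strict n zero    v a _   _   _   r≢0 = ⊥-elim (r≢0 refl)
  denominator-strict n (suc u) v a n≥1 u<v a≥1 =
    strict (remainder n (suc u) v) (ℕD.m≡m%n+[m/n]*n (c n *ℕ v) (suc u)) (ℕD.m%n<n (c n *ℕ v) (suc u))
    where
    A = denominator n (suc u) v a
    A≥1 = denominator≥1 n (suc u) v a n≥1 u<v a≥1
    strict : ∀ r → c n *ℕ v ≡ r +ℕ A *ℕ suc u → r <ℕ suc u → r ≢ 0 →
               remainder (suc n) r (A *ℕ v) ≢ 0
             ⊎ c (suc n) *ℕ A *ℕ (A +ℕ 1) <ℕ c n *ℕ denominator (suc n) r (A *ℕ v) A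
    strict zero    _   _   r≢0 = ⊥-elim (r≢0 refl)
    strict (suc w) cv≡ r<s _ with (c (suc n) *ℕ (A *ℕ v)) % suc w in r'≡
    ... | suc _ = inj₁ (λ ())
    ... | zero  = inj₂ (ℕP.*-cancelʳ-< (suc w) _ _ (begin-strict
      c (suc n) *ℕ A *ℕ (A +ℕ 1) *ℕ suc w  ≡⟨ ℕP.*-assoc (c (suc n) *ℕ A) (A +ℕ 1) (suc w) ⟩
      c (suc n) *ℕ A *ℕ ((A +ℕ 1) *ℕ suc w) <⟨ ℕP.*-monoʳ-< (c (suc n) *ℕ A) {{ℕ.>-nonZero c'A≥1}}
                                                 (quotient-remainder-< cv≡ r<s A≥1) ⟩
      c (suc n) *ℕ A *ℕ (c n *ℕ v)
        ≡⟨ ℕS.solve 4 (λ C' A C v → C' ℕS.:* A ℕS.:* (C ℕS.:* v)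
                                     ℕS.:= C ℕS.:* (C' ℕS.:* (A ℕS.:* v))) refl (c (suc n)) A (c n) v ⟩
      c n *ℕ (c (suc n) *ℕ (A *ℕ v))        ≡⟨ cong (c n *ℕ_) exact ⟩
      c n *ℕ (A' *ℕ suc w)                  ≡⟨ ℕP.*-assoc (c n) A' (suc w) ⟨
      c n *ℕ A' *ℕ suc w                    ∎))
      where
      open ℕP.≤-Reasoning
      A' = c (suc n) *ℕ (A *ℕ v) /ℕ suc w
      c'A≥1 : 1 ≤ℕ c (suc n) *ℕ A
      c'A≥1 = ℕP.*-mono-≤ (c≥1 (suc n) (s≤s z≤n)) A≥1
      exact : c (suc n) *ℕ (A *ℕ v) ≡ A' *ℕ suc w
      exact = trans (ℕD.m≡m%n+[m/n]*n (c (suc n) *ℕ (A *ℕ v)) (suc w)) (cong (_+ℕ A' *ℕ suc w) r'≡)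

  Y₁<1-if-Y₂≡0 : Y 2 ≡ 0ℚ → Y 1 < 1ℚ
  Y₁<1-if-Y₂≡0 Y₂≡0 = subst (_< 1ℚ) (sym Y₁≡u₁/D)
    (*<*⇒frac< u₁ 1 D≥1 (s≤s z≤n)
      (subst₂ _<ℕ_ (sym (ℕP.*-identityʳ u₁)) (sym (ℕP.*-identityˡ D)) u₁<D))
    where
    tail₂≡0 : tail 2 ≡ 0ℚ
    tail₂≡0 = trans (cong (λ u → frac u (den 2)) (Y≡0⇒num≡0 2 (s≤s z≤n) Y₂≡0)) (frac-zero (den 2))
    Y₁≡u₁/D : Y 1 ≡ frac u₁ D
    Y₁≡u₁/D = trans (Y≡tail+tail 0) (trans (cong (tail 1 +_) tail₂≡0) (+-identityʳ (tail 1)))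

  Y∈S : InS c Y
  Y∈S = (z , refl)
      , Y≤1
      , (λ Y₁≡1 Y₂≡0 → <-irrefl Y₁≡1 (Y₁<1-if-Y₂≡0 Y₂≡0))
      , (λ m m≥1 Yₘ≡0 n m≤n → num≡0⇒Y≡0 n (ℕP.≤-trans m≥1 m≤n)
                                 (num-stays-zero m≥1 m≤n (Y≡0⇒num≡0 m m≥1 Yₘ≡0)))
      , (a' , (λ n _ → a'≥1 n) , growth , shape , strict)
    where
    Y≤1 : ∀ n → 1 ≤ℕ n → Y n ≤ 1ℚ
    Y≤1 (suc k) k≥1 = digit≤1 (suc k) (num (suc k)) (den (suc k)) (a' k) k≥1 (num<den k) (a'≥1 k)
    growth : ∀ n → 1 ≤ℕ n → GrowthGe c a' n
    growth (suc k) k≥1 = denominator-growth (suc k) (num (suc k)) (den (suc k)) (a' k) k≥1 (num<den k) (a'≥1 k)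
    shape : ∀ n → 1 ≤ℕ n → Y n ≢ 0ℚ → Y n ≡ frac (c n) (a' n)
    shape (suc k) _ = digit≢0⇒≡c/a {suc k} {num (suc k)} {a' (suc k)}
    strict : ∀ n → 1 ≤ℕ n → Y (suc n) ≢ 0ℚ → Y (suc (suc n)) ≢ 0ℚ ⊎ GrowthGt c a' n
    strict (suc k) k≥1 Y≢0
      with denominator-strict (suc k) (num (suc k)) (den (suc k)) (a' k) k≥1 (num<den k) (a'≥1 k)
                                  (λ num≡0 → Y≢0 (num≡0⇒Y≡0 (suc (suc k)) (s≤s z≤n) num≡0))
    ... | inj₁ num≢0 = inj₁ (λ Y≡0 → num≢0 (Y≡0⇒num≡0 (suc (suc (suc k))) (s≤s z≤n) Y≡0))
    ... | inj₂ gt    = inj₂ gt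

  Y-represents : Represents c Y value
  Y-represents = Y∈S , suc u₁ , s≤s z≤n , num≡0⇒Y≡0 (suc u₁) (s≤s z≤n) num-terminates , sym (begin
    value                                             ≡⟨ value≡trunc+tail (suc u₁) ⟩
    T + sgnTerm (suc (suc u₁)) (tail (suc (suc u₁)))  ≡⟨ cong (T +_) last-term≡0 ⟩
    T + 0ℚ                                            ≡⟨ +-identityʳ T ⟩
    T                                                 ∎)
    where
    open ≡-Reasoning
    T = trunc Y (suc u₁)
    tail≡0 : tail (suc (suc u₁)) ≡ 0ℚ
    tail≡0 = trans (cong (λ u → frac u (den (suc (suc u₁))))
                         (num-stays-zero (s≤s z≤n) (ℕP.n≤1+n (suc u₁)) num-terminates))
                   (frac-zero (den (suc (suc u₁))))
    last-term≡0 : sgnTerm (suc (suc u₁)) (tail (suc (suc u₁))) ≡ 0ℚ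
    last-term≡0 = trans (cong (sgnTerm (suc (suc u₁))) tail≡0) (sgnTerm-zero (suc (suc u₁)))

rational-representable : ∀ c → ValidC c → ∀ q → ∃[ Y ] Represents c Y q
rational-representable c vc q@(mkℚ n d _) = E.Y , subst (Represents c E.Y) value≡q E.Y-represents
  where
  z = n ℤD./ℕ suc d
  u₁ = n ℤD.%ℕ suc d
  module E = Expansion c vc z u₁ (suc d) (s≤s z≤n) (ℤD.n%ℕd<d n (suc d))
  cross : (z ℤ.* ℤ.+ suc d ℤ.+ ℤ.+ u₁ ℤ.* ℤ.+ 1) ℤ.* ℤ.+ suc d ≡ n ℤ.* ℤ.+ suc (d ℕ.+ 0)
  cross = trans (ℤS.solve 3 (λ z u D → (z ℤS.:* D ℤS.:+ u ℤS.:* ℤS.con (ℤ.+ 1)) ℤS.:* D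
                                        ℤS.:= (u ℤS.:+ z ℤS.:* D) ℤS.:* D)
                             refl z (ℤ.+ u₁) (ℤ.+ suc d))
                (cong₂ ℤ._*_ (sym (ℤD.a≡a%ℕn+[a/ℕn]*n n (suc d)))
                             (cong (λ w → ℤ.+ suc w) (sym (ℕP.+-identityʳ d))))
  value≡q : E.value ≡ q
  value≡q = toℚᵘ-injective (ℚᵘP.≃-trans (toℚᵘ-homo-+ (z / 1) (frac u₁ (suc d)))
    (ℚᵘP.≃-trans (ℚᵘP.+-cong (toℚᵘ-fromℚᵘ (ℚᵘ.mkℚᵘ z 0)) (frac-toℚᵘ u₁ d))
                 (ℚᵘ.*≡* cross)))

represents⇒trunc-eventually : ∀ {c Y r} → Represents c Y r → ∃[ m ] (∀ k → m ≤ℕ k → trunc Y k ≡ r)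
represents⇒trunc-eventually {Y = Y} (Y∈S , m , m≥1 , Yₘ≡0 , truncₘ≡r) =
  m , λ k m≤k → trans (beyond (λ k → trunc Y k ≡ trunc Y m) m≤k constant) truncₘ≡r
  where
  zero-persists = proj₁ (proj₂ (proj₂ (proj₂ Y∈S)))
  constant : ∀ d → trunc Y (m +ℕ d) ≡ trunc Y m
  constant zero    = cong (trunc Y) (ℕP.+-identityʳ m)
  constant (suc d) rewrite ℕP.+-suc m d = begin
    trunc Y (m +ℕ d) + sgnTerm (suc (m +ℕ d)) (Y (suc (m +ℕ d)))
      ≡⟨ cong₂ (λ t y → t + sgnTerm (suc (m +ℕ d)) y) (constant d)
               (zero-persists m m≥1 Yₘ≡0 _ (ℕP.m≤n⇒m≤1+n (ℕP.m≤m+n m d))) ⟩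
    trunc Y m + sgnTerm (suc (m +ℕ d)) 0ℚ
      ≡⟨ cong (trunc Y m +_) (sgnTerm-zero (suc (m +ℕ d))) ⟩
    trunc Y m + 0ℚ
      ≡⟨ +-identityʳ (trunc Y m) ⟩
    trunc Y m ∎
    where open ≡-Reasoning

-- Trichotomy of the order on S

first-difference : ∀ (P Q : ℕ → ℚ) n →
  (∀ k → k <ℕ n → P k ≡ Q k) ⊎ ∃[ j ] (P j ≢ Q j × (∀ k → k <ℕ j → P k ≡ Q k))
first-difference P Q zero = inj₁ (λ k ())
first-difference P Q (suc n) with first-difference P Q n
... | inj₂ found = inj₂ found
... | inj₁ agree with P n ≟ Q n
...   | no  Pn≢Qn = inj₂ (n , Pn≢Qn , agree)
...   | yes Pn≡Qn = inj₁ extend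
  where
  extend : ∀ k → k <ℕ suc n → P k ≡ Q k
  extend k k<1+n with ℕP.m≤n⇒m<n∨m≡n (ℕP.≤-pred k<1+n)
  ... | inj₁ k<n  = agree k k<n
  ... | inj₂ refl = Pn≡Qn

cmpAt-either : ∀ j {p q} → p < q → cmpAt j p q ⊎ cmpAt j q p
cmpAt-either zero    p<q = inj₁ p<q
cmpAt-either (suc j) p<q with isOdd (suc j)
... | true  = inj₁ p<q
... | false = inj₂ p<q

first-difference-decides : ∀ {P Q j} → (∀ k → k <ℕ j → P k ≡ Q k) →
  cmpAt j (P j) (Q j) ⊎ cmpAt j (Q j) (P j) → P <S Q ⊎ P ≈S Q ⊎ Q <S P
first-difference-decides {j = j} agree (inj₁ P<Q) = inj₁ (j , agree , P<Q)
first-difference-decides {j = j} agree (inj₂ Q<P) = inj₂ (inj₂ (j , (λ k k<j → sym (agree k k<j)) , Q<P))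

<S-trichotomous : ExcludedMiddle 0ℓ → ∀ P Q → P <S Q ⊎ P ≈S Q ⊎ Q <S P
<S-trichotomous em P Q with em {∃[ i ] P i ≢ Q i}
... | no ¬differ = inj₂ (inj₁ pointwise)
  where
  pointwise : P ≈S Q
  pointwise n with P n ≟ Q n
  ... | yes Pn≡Qn = Pn≡Qn
  ... | no  Pn≢Qn = ⊥-elim (¬differ (n , Pn≢Qn))
... | yes (i , Pi≢Qi) with first-difference P Q (suc i)
...   | inj₁ agree = ⊥-elim (Pi≢Qi (agree i (ℕP.n<1+n i)))
...   | inj₂ (j , Pj≢Qj , agree) with <-cmp (P j) (Q j)
...     | tri≈ _ Pj≡Qj _ = ⊥-elim (Pj≢Qj Pj≡Qj)
...     | tri< Pj<Qj _ _ = first-difference-decides agree (cmpAt-either j Pj<Qj)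
...     | tri> _ _ Qj<Pj = first-difference-decides agree (swap (cmpAt-either j Qj<Pj))

-- Representatives and the supremum

module _ (c : ℕ → ℕ) (vc : ValidC c) where

  represented-≤S⇒≤-odd-trunc : ∀ {Y X r} → Represents c Y r → InS c X → Y ≤S X →
                               ∀ t → r ≤ trunc X (suc (2 *ℕ t))
  represented-≤S⇒≤-odd-trunc {Y} {X} {r} Y-rep X∈S Y≤X t = begin
    r                       ≡⟨ trunc≡r (suc j) (ℕP.m≤n⇒m≤1+n (ℕP.m≤n⇒m≤1+n (m≤2*[m+n] m t))) ⟨
    trunc Y (suc j)         ≤⟨ Comparison.≤S⇒trunc-≤ c vc (proj₁ Y-rep) X∈S Y≤X {j} (isOdd-1+2* (m +ℕ t)) ⟩
    trunc X j               ≤⟨ Digits.trunc-≤-odd c vc X∈S (isOdd-1+2* t) 1+2t≤j ⟩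
    trunc X (suc (2 *ℕ t))  ∎
    where
    open ≤-Reasoning
    m = proj₁ (represents⇒trunc-eventually Y-rep)
    trunc≡r = proj₂ (represents⇒trunc-eventually Y-rep)
    j = suc (2 *ℕ (m +ℕ t))
    1+2t≤j : suc (2 *ℕ t) ≤ℕ j
    1+2t≤j = s≤s (ℕP.*-monoʳ-≤ 2 (ℕP.m≤n+m t m))

  ≤S-represented⇒even-trunc-≤ : ∀ {X Z ρ} → InS c X → Represents c Z ρ → X ≤S Z →
                                ∀ M → trunc X (2 *ℕ M) ≤ ρ
  ≤S-represented⇒even-trunc-≤ {X} {Z} {ρ} X∈S Z-rep X≤Z M = begin
    trunc X (2 *ℕ M)  ≤⟨ Digits.even-trunc-≤ c vc X∈S (isOdd-2* M) 2M≤1+j ⟩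
    trunc X (suc j)   ≤⟨ Comparison.≤S⇒trunc-≤ c vc X∈S (proj₁ Z-rep) X≤Z {j} (isOdd-1+2* (m +ℕ M)) ⟩
    trunc Z j         ≡⟨ trunc≡ρ j (ℕP.m≤n⇒m≤1+n (m≤2*[m+n] m M)) ⟩
    ρ                 ∎
    where
    open ≤-Reasoning
    m = proj₁ (represents⇒trunc-eventually Z-rep)
    trunc≡ρ = proj₂ (represents⇒trunc-eventually Z-rep)
    j = suc (2 *ℕ (m +ℕ M))
    2M≤1+j : 2 *ℕ M ≤ℕ suc j
    2M≤1+j = ℕP.m≤n⇒m≤1+n (ℕP.m≤n⇒m≤1+n (ℕP.*-monoʳ-≤ 2 (ℕP.m≤n+m M m)))

  represented-<S⇒≤ : ∀ {Y Z r ρ} → Represents c Z ρ → Represents c Y r → Z <S Y → ρ ≤ r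
  represented-<S⇒≤ {Y} {r = r} Z-rep Y-rep Z<Y =
    subst (_ ≤_) (trunc≡r (suc (2 *ℕ m)) (ℕP.m≤n⇒m≤1+n (ℕP.m≤m+n m (m +ℕ 0))))
      (represented-≤S⇒≤-odd-trunc Z-rep (proj₁ Y-rep) (inj₁ Z<Y) m)
    where
    m = proj₁ (represents⇒trunc-eventually Y-rep)
    trunc≡r = proj₂ (represents⇒trunc-eventually Y-rep)

module Supremum (c : ℕ → ℕ) (vc : ValidC c) (a : ℕ → ℚ) {X : ℕ → ℚ} (X-sup : IsSupS c a X) where
  private
    X∈S = proj₁ X-sup
    X-upper = proj₁ (proj₂ X-sup)
    X-least = proj₂ (proj₂ X-sup)

  term≤trunc[2n-1] : ∀ n → 1 ≤ℕ n → a n ≤ trunc X (2 *ℕ n ∸ 1)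
  term≤trunc[2n-1] (suc n) n≥1 with rational-representable c vc (a (suc n))
  ... | Y , Y-rep = subst (λ j → a (suc n) ≤ trunc X j) (sym (2*[1+n]∸1≡1+2*n n))
    (represented-≤S⇒≤-odd-trunc c vc Y-rep X∈S (X-upper (suc n) n≥1 Y Y-rep) n)

  above-terms⇒upper-bound : ExcludedMiddle 0ℓ → ∀ {Z ρ} → Represents c Z ρ →
                            (∀ n → 1 ≤ℕ n → a n < ρ) → IsUpperBoundS c a Z
  above-terms⇒upper-bound em {Z} Z-rep a<ρ n n≥1 Y Y-rep with <S-trichotomous em Y Z
  ... | inj₁ Y<Z         = inj₁ Y<Z
  ... | inj₂ (inj₁ Y≈Z)  = inj₂ Y≈Z
  ... | inj₂ (inj₂ Z<Y)  =
    ⊥-elim (<-irrefl refl (<-≤-trans (a<ρ n n≥1) (represented-<S⇒≤ c vc Z-rep Y-rep Z<Y)))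

  even-trunc-approached : ExcludedMiddle 0ℓ → ∀ M ρ → ρ < trunc X (2 *ℕ M) →
                          ∃[ n ] (1 ≤ℕ n × ρ ≤ a n)
  even-trunc-approached em M ρ ρ<X₂ₘ with em {∃[ n ] (1 ≤ℕ n × ρ ≤ a n)}
  ... | yes found = found
  ... | no  ¬found with rational-representable c vc ρ
  ...   | Z , Z-rep = ⊥-elim (<-irrefl refl (<-≤-trans ρ<X₂ₘ
            (≤S-represented⇒even-trunc-≤ c vc X∈S Z-rep X≤Z M)))
    where
    a<ρ : ∀ n → 1 ≤ℕ n → a n < ρ
    a<ρ n n≥1 = ≰⇒> (λ ρ≤aₙ → ¬found (n , n≥1 , ρ≤aₙ))
    X≤Z : X ≤S Z
    X≤Z = X-least Z (proj₁ Z-rep) (above-terms⇒upper-bound em Z-rep a<ρ)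

squeeze : ∀ {a x : ℕ → ℚ} t δ {ε n₀ L} →
          (∀ n → 1 ≤ℕ n → a n ≤ a (suc n)) → 1 ≤ℕ n₀ → t - δ ≤ a n₀ →
          (∀ n → 1 ≤ℕ n → a n ≤ x n) → (∀ n → L ≤ℕ n → x n ≤ t + δ) → δ + δ < ε →
          ∀ n → n₀ +ℕ L ≤ℕ n → ∣ x n - a n ∣ < ε
squeeze t δ a-mono n₀≥1 t-δ≤aₙ₀ a≤x x≤t+δ 2δ<ε n n₀+L≤n = ≤-<-trans
  (∣x-y∣≤δ+δ {t = t} {δ} (a≤x n (ℕP.≤-trans n₀≥1 n₀≤n))
    (≤-trans t-δ≤aₙ₀ (monotone⇒≤ a-mono n₀≥1 n₀≤n)) (x≤t+δ n L≤n))
  2δ<ε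
  where
  n₀≤n = ℕP.≤-trans (ℕP.m≤m+n _ _) n₀+L≤n
  L≤n = ℕP.≤-trans (ℕP.m≤n+m _ _) n₀+L≤n

lemma3p11 : ExcludedMiddle 0ℓ →
    (c : ℕ → ℕ) → ValidC c →
    (a : ℕ → ℚ) → (∀ n → 1 ≤ℕ n → a n ≤ a (suc n)) →
    (∃[ B ] (∀ n → 1 ≤ℕ n → a n ≤ B)) →
    (X : ℕ → ℚ) → IsSupS c a X →
    ∀ m → 1 ≤ℕ m → ∃[ N ] (∀ n → N ≤ℕ n → 1 ≤ℕ n →
      ∣ trunc X (2 *ℕ n ∸ 1) - a n ∣ < frac 1 m)
-- Boundedness only guarantees that the supremum exists, which IsSupS already provides.
lemma3p11 em c vc a a-mono _ X X-sup m m≥1 = n₀ +ℕ suc (suc m) , λ n n≥N _ →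
  squeeze (trunc X K) δ a-mono n₀≥1 t-δ≤aₙ₀ term≤trunc[2n-1] near (1/K+1/K<1/m m≥1 2m<K) n n≥N
  where
  open Supremum c vc a X-sup
  K = 2 *ℕ suc m
  δ = frac 1 K
  2m<K : 2 *ℕ m <ℕ K
  2m<K = ℕP.*-monoʳ-< 2 (ℕP.n<1+n m)
  approached = even-trunc-approached em (suc m) (trunc X K - δ)
    (p-q<p (trunc X K) (0<frac {1} {K} (s≤s z≤n) (s≤s z≤n)))
  n₀ = proj₁ approached
  n₀≥1 = proj₁ (proj₂ approached)
  t-δ≤aₙ₀ = proj₂ (proj₂ approached)
  near : ∀ n → suc (suc m) ≤ℕ n → trunc X (2 *ℕ n ∸ 1) ≤ trunc X K + δ
  near n 2+m≤n = Digits.trunc-≤-even+1/i c vc (proj₁ X-sup) (s≤s z≤n) (isOdd-2* (suc m))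
                   (2+m≤n⇒2*[1+m]≤2*n∸1 2+m≤n)
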